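{- Let $r \geq 2$ be even, $k \geq 1$, and let $H$ be an $r$-uniform cgh on $\Omega_n$. Let $\mathsf P = v_0 v_1 \dots v_{k+r-2}$ be a $k$-zigzag in $H$ with end $\mathbf{v}_k = (v_{k-1}, v_k, \dots, v_{k+r-2})$. Then for any $v_{k+r-1} \in X(\mathbf{v}_k)$, the sequence $v_0 v_1 \dots v_{k+r-2} v_{k+r-1}$ (i.e. $\mathsf P$ together with the edge $\{v_k, v_{k+1}, \dots, v_{k+r-1}\}$) is a $(k+1)$-zigzag in $H$ with end $\mathbf{v}_{k+1} = (v_k, v_{k+1}, \dots, v_{k+r-1})$.
   Context: $\Omega_n$ is a set of $n$ points in strictly convex position in the plane with cyclic (clockwise) ordering $\prec$; for $u,v\in\Omega_n$, $[u,v]$ is the set of points met going clockwise from $u$ to $v$, including $u$ and $v$. An $r$-uniform cgh on $\Omega_n$ is a set $H$ of $r$-subsets of $\Omega_n$. Segments of $\Omega_n$ are sets of cyclically consecutive points, each linearly ordered clockwise; disjoint segments satisfy $I_0 \prec \dots \prec I_{r-1}$ if they appear in this order going once around clockwise. For even $r$, a $k$-zigzag in $H$ is a sequence of distinct points $v_0,\dots,v_{k+r-2}$ with $\{v_i,\dots,v_{i+r-1}\}\in H$ for $0\le i<k$, for which there are disjoint segments $I_0 \prec \dots \prec I_{r-1}$ with $\{v_i : i\equiv j \pmod r\}\subseteq I_j$, such that for even $j$: $v_j \prec v_{j+r} \prec v_{j+2r}\prec\cdots$ in $I_j$, and for odd $j$: $v_j \succ v_{j+r}\succ v_{j+2r}\succ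 \cdots$ in $I_j$. The end of the $k$-zigzag is the $r$-tuple $\mathbf v_k=(v_{k-1},v_k,\dots,v_{k+r-2})$. Set $I(\mathbf v_k)=[v_{k-1},v_k]$ if $k$ is odd and $I(\mathbf v_k)=[v_{k+r-2},v_{k-1}]$ if $k$ is even, and $X(\mathbf v_k)=\{v\in I(\mathbf v_k)\setminus\{v_{k-1}\} : \{v,v_k,v_{k+1},\dots,v_{k+r-2}\}\in H\}$ (in particular $v$ is distinct from $v_{k-1},\dots,v_{k+r-2}$ since the edge is an $r$-set). -}

module Defs where

open import Data.Nat using (ℕ; zero; suc; _+_; _*_; _∸_; _≤_; _<_; _≤ᵇ_)
open import Data.Nat.Divisibility using (_∣_)
open import Data.Bool using (if_then_else_)
open import Data.Fin using (Fin; toℕ)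
open import Data.Fin.Subset using (Subset; ⊥; ⁅_⁆; _∪_; _∈_; ∣_∣)
open import Data.Product using (Σ; _×_; ∃₂)
open import Data.Sum using (_⊎_)
open import Data.Nat.Properties using (_≟_)
open import Relation.Nullary using (¬_; yes; no)
open import Relation.Binary.PropositionalEquality using (_≡_)

-- Ω_n is modelled by Fin n; the clockwise cyclic order is the order
-- 0 → 1 → … → n-1 → 0 of the indices.

offset : {n : ℕ} → Fin n → Fin n → ℕ
offset {n} a x =
  if toℕ a ≤ᵇ toℕ x then toℕ x ∸ toℕ a else (n ∸ toℕ a) + toℕ x

_∈[_,_] : {n : ℕ} → Fin n → Fin n → Fin n → Set
x ∈[ u , w ] = offset u x ≤ offset u w

-- segment with first point a and length ℓ : the points a, a+1, …, a+ℓ-1 (mod n),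
-- linearly ordered clockwise starting from a (i.e. by offset a).
_∈Seg_,_ : {n : ℕ} → Fin n → Fin n → ℕ → Set
x ∈Seg a , ℓ = offset a x < ℓ

record CGH (n r : ℕ) : Set₁ where
  field
    Edge    : Subset n → Set
    uniform : ∀ e → Edge e → ∣ e ∣ ≡ r
open CGH public

block : {n : ℕ} → (ℕ → Fin n) → ℕ → ℕ → Subset n
block v i zero    = ⊥
block v i (suc m) = ⁅ v i ⁆ ∪ block v (suc i) m

Even : ℕ → Set
Even j = 2 ∣ j

-- Sequences are given as functions ℕ → Fin n; a k-zigzag is the sequence
-- v 0, …, v (k+r-2), i.e. only the values at indices < k + r - 1 matter.
record IsZigzag {n r : ℕ} (H : CGH n r) (k : ℕ) (v : ℕ → Fin n) : Set where
  field
    distinct : ∀ i j → i < k + r ∸ 1 → j < k + r ∸ 1 → v i ≡ v j → i ≡ j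
    edges    : ∀ i → i < k → Edge H (block v i r)
    start    : ℕ → Fin n
    len      : ℕ → ℕ
    -- disjoint and I_0 ≺ I_1 ≺ … ≺ I_{r-1} going once around clockwise
    ordered  : ∀ j → suc j < r →
                 offset (start 0) (start j) + len j ≤ offset (start 0) (start (suc j))
    wrap     : offset (start 0) (start (r ∸ 1)) + len (r ∸ 1) ≤ n
    inSeg    : ∀ q j → j < r → q * r + j < k + r ∸ 1 →
                 v (q * r + j) ∈Seg start j , len j
    monoEven : ∀ q j → j < r → Even j → suc q * r + j < k + r ∸ 1 →
                 offset (start j) (v (q * r + j)) < offset (start j) (v (suc q * r + j))
    monoOdd  : ∀ q j → j < r → ¬ Even j → suc q * r + j < k + r ∸ 1 →
                 offset (start j) (v (suc q * r + j)) < offset (start j) (v (q * r + j))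

_∈I[_,_,_] : {n : ℕ} → Fin n → ℕ → ℕ → (ℕ → Fin n) → Set
x ∈I[ r , k , v ] =
  (¬ Even k × x ∈[ v (k ∸ 1) , v k ]) ⊎ (Even k × x ∈[ v (k + r ∸ 2) , v (k ∸ 1) ])

_∈X[_,_,_] : {n r : ℕ} → Fin n → CGH n r → ℕ → (ℕ → Fin n) → Set
_∈X[_,_,_] {r = r} x H k v =
  x ∈I[ r , k , v ] × ¬ (x ≡ v (k ∸ 1)) × Edge H (⁅ x ⁆ ∪ block v k (r ∸ 1))

snoc : {n : ℕ} → (ℕ → Fin n) → ℕ → Fin n → ℕ → Fin n
snoc v m x i with i ≟ m
... | yes _ = x
... | no  _ = v i

module Submission where

-- Cut the circle at the first point s0 of the segment I_0 and give every point y
-- the position P y = offset s0 y ∈ [0, n).  The segments then become disjoint,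
-- increasing intervals [P (first j), end j) (a frame), and a zigzag is the same
-- as a sequence whose terms of index q r + j lie in the j-th interval (InFrame)
-- and increase along even classes j, decrease along odd ones (Alternating);
-- distinctness of the terms follows from these two properties.
-- The new point x gets index k + r - 1, in the class j0 of v_{k-1}, right after
-- it.  For odd k the point x ∈ [v_{k-1}, v_k] lies between the last terms of
-- classes j0 and j0 + 1; for even k, x ∈ [v_{k+r-2}, v_{k-1}] lies between the
-- last terms of classes j0 - 1 and j0.  Moving the boundary between these two
-- segments next to x gives a frame holding all old terms and x, and x continues
-- its class in the right direction; the new edge is the one given by X(v_k).

open import Defs
open import Data.Nat using (ℕ; zero; suc; _+_; _*_; _∸_; _≤_; _<_; _≤ᵇ_; z≤n; s≤s; s≤s⁻¹; NonZero)
open import Data.Nat.Properties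
open import Function using (_∘_)
open import Data.Nat.Tactic.RingSolver using (solve-∀)
open import Data.Nat.DivMod using (_/_; _%_; m%n<n; m≡m%n+[m/n]*n)
open import Data.Nat.Divisibility using (divides; _∣?_; ∣m+n∣m⇒∣n; ∣m∣n⇒∣m+n; ∣n⇒∣m*n)
open import Data.Bool using (true; false)
open import Data.Fin using (Fin; toℕ)
open import Data.Fin.Properties using (toℕ<n; toℕ-injective)
open import Data.Fin.Subset using (Subset; ⁅_⁆; _∪_; _∈_; _⊆_; ∣_∣; inside; outside)
open import Data.Fin.Subset.Properties
  using (∣⊥∣≡0; ∣⁅x⁆∣≡1; x∈⁅x⁆; x∈⁅y⁆⇒x≡y; x∈p∪q⁻; x∈p∪q⁺; p⊆q⇒∣p∣≤∣q∣;
         ∪-assoc; ∪-comm; ∪-identityˡ; ∪-identityʳ)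
open import Data.Vec using ([]; _∷_)
open import Data.Product using (Σ; _×_; _,_; proj₁; proj₂)
open import Data.Sum using (_⊎_; inj₁; inj₂)
open import Relation.Nullary using (¬_; Dec; yes; no; contradiction)
open import Relation.Binary.Definitions using (tri<; tri≈; tri>)
open import Relation.Binary.PropositionalEquality

∣p∪q∣≤∣p∣+∣q∣ : ∀ {n} (p q : Subset n) → ∣ p ∪ q ∣ ≤ ∣ p ∣ + ∣ q ∣
∣p∪q∣≤∣p∣+∣q∣ []            []            = z≤n
∣p∪q∣≤∣p∣+∣q∣ (outside ∷ p) (outside ∷ q) = ∣p∪q∣≤∣p∣+∣q∣ p q
∣p∪q∣≤∣p∣+∣q∣ (inside  ∷ p) (outside ∷ q) = s≤s (∣p∪q∣≤∣p∣+∣q∣ p q)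
∣p∪q∣≤∣p∣+∣q∣ (outside ∷ p) (inside  ∷ q) =
  ≤-trans (s≤s (∣p∪q∣≤∣p∣+∣q∣ p q)) (≤-reflexive (sym (+-suc _ _)))
∣p∪q∣≤∣p∣+∣q∣ (inside  ∷ p) (inside  ∷ q) =
  s≤s (≤-trans (m≤n⇒m≤1+n (∣p∪q∣≤∣p∣+∣q∣ p q)) (≤-reflexive (sym (+-suc _ _))))

∣block∣≤ : ∀ {n} (f : ℕ → Fin n) i m → ∣ block f i m ∣ ≤ m
∣block∣≤ {n} f i zero    = ≤-reflexive (∣⊥∣≡0 n)
∣block∣≤     f i (suc m) = begin
  ∣ ⁅ f i ⁆ ∪ block f (suc i) m ∣       ≤⟨ ∣p∪q∣≤∣p∣+∣q∣ ⁅ f i ⁆ _ ⟩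
  ∣ ⁅ f i ⁆ ∣ + ∣ block f (suc i) m ∣   ≡⟨ cong (_+ ∣ block f (suc i) m ∣) (∣⁅x⁆∣≡1 (f i)) ⟩
  suc ∣ block f (suc i) m ∣             ≤⟨ s≤s (∣block∣≤ f (suc i) m) ⟩
  suc m                                 ∎
  where open ≤-Reasoning

∈block : ∀ {n} (f : ℕ → Fin n) i m t → t < m → f (i + t) ∈ block f i m
∈block f i (suc m) zero    _          rewrite +-identityʳ i = x∈p∪q⁺ (inj₁ (x∈⁅x⁆ (f i)))
∈block f i (suc m) (suc t) (s≤s t<m) rewrite +-suc i t     = x∈p∪q⁺ (inj₂ (∈block f (suc i) m t t<m))

block-cong : ∀ {n} (f g : ℕ → Fin n) i m →
  (∀ t → t < m → f (i + t) ≡ g (i + t)) → block f i m ≡ block g i m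
block-cong f g i zero    f≗g = refl
block-cong f g i (suc m) f≗g = cong₂ _∪_
  (cong ⁅_⁆ (subst (λ j → f j ≡ g j) (+-identityʳ i) (f≗g 0 (s≤s z≤n))))
  (block-cong f g (suc i) m λ t t<m → subst (λ j → f j ≡ g j) (+-suc i t) (f≗g (suc t) (s≤s t<m)))

block-snoc : ∀ {n} (f : ℕ → Fin n) i m → block f i (suc m) ≡ block f i m ∪ ⁅ f (i + m) ⁆
block-snoc f i zero    rewrite +-identityʳ i = trans (∪-identityʳ _) (sym (∪-identityˡ _))
block-snoc f i (suc m) rewrite block-snoc f (suc i) m | +-suc i m =
  sym (∪-assoc ⁅ f i ⁆ (block f (suc i) m) _)

-- In an r-uniform cgh, an edge {x} ∪ {f k, …, f (k+r-2)} has r elements, so x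
-- is none of the f (k + t): otherwise the edge would have at most r - 1 points.
edge-avoids-block : ∀ {n r} (H : CGH n (suc r)) (x : Fin n) (f : ℕ → Fin n) k →
  Edge H (⁅ x ⁆ ∪ block f k r) → ∀ t → t < r → x ≢ f (k + t)
edge-avoids-block {r = r} H x f k edge t t<r refl = n≮n r (begin-strict
  r                       <⟨ n<1+n r ⟩
  suc r                   ≡⟨ sym (uniform H _ edge) ⟩
  ∣ ⁅ x ⁆ ∪ block f k r ∣ ≤⟨ p⊆q⇒∣p∣≤∣q∣ absorbed ⟩
  ∣ block f k r ∣         ≤⟨ ∣block∣≤ f k r ⟩
  r                       ∎)
  where
  open ≤-Reasoning
  absorbed : ⁅ x ⁆ ∪ block f k r ⊆ block f k r
  absorbed {y} y∈ with x∈p∪q⁻ ⁅ x ⁆ _ y∈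
  ... | inj₁ y∈⁅x⁆ rewrite x∈⁅y⁆⇒x≡y x y∈⁅x⁆ = ∈block f k r t t<r
  ... | inj₂ y∈B = y∈B

module _ {n : ℕ} where

  offset-≤ : (a y : Fin n) → toℕ a ≤ toℕ y → offset a y ≡ toℕ y ∸ toℕ a
  offset-≤ a y a≤y with toℕ a ≤ᵇ toℕ y | ≤⇒≤ᵇ a≤y
  ... | true | _ = refl

  offset-> : (a y : Fin n) → toℕ y < toℕ a → offset a y ≡ n ∸ toℕ a + toℕ y
  offset-> a y y<a with toℕ a ≤ᵇ toℕ y | ≤ᵇ⇒≤ (toℕ a) (toℕ y)
  ... | true  | a≤y = contradiction (a≤y _) (<⇒≱ y<a)
  ... | false | _   = refl

  unwrap-≤ : (a y : Fin n) → toℕ a ≤ toℕ y → toℕ a + offset a y ≡ toℕ y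
  unwrap-≤ a y a≤y = trans (cong (toℕ a +_) (offset-≤ a y a≤y)) (m+[n∸m]≡n a≤y)

  unwrap-> : (a y : Fin n) → toℕ y < toℕ a → toℕ a + offset a y ≡ n + toℕ y
  unwrap-> a y y<a = begin
    toℕ a + offset a y            ≡⟨ cong (toℕ a +_) (offset-> a y y<a) ⟩
    toℕ a + (n ∸ toℕ a + toℕ y)   ≡⟨ +-assoc (toℕ a) _ _ ⟨
    toℕ a + (n ∸ toℕ a) + toℕ y   ≡⟨ cong (_+ toℕ y) (m+[n∸m]≡n (<⇒≤ (toℕ<n a))) ⟩
    n + toℕ y                     ∎
    where open ≡-Reasoning

  offset-unwrapped-< : (s y : Fin n) → toℕ s ≤ toℕ y → offset s y < n ∸ toℕ s
  offset-unwrapped-< s y s≤y rewrite offset-≤ s y s≤y = ∸-monoˡ-< (toℕ<n y) s≤y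

  offset-wrapped-≥ : (s a : Fin n) → toℕ a < toℕ s → n ∸ toℕ s ≤ offset s a
  offset-wrapped-≥ s a a<s rewrite offset-> s a a<s = m≤m+n _ _

  offset<n : (a y : Fin n) → offset a y < n
  offset<n a y with toℕ a ≤? toℕ y
  ... | yes a≤y rewrite offset-≤ a y a≤y = ≤-<-trans (m∸n≤m (toℕ y) (toℕ a)) (toℕ<n y)
  ... | no  a>y = +-cancelˡ-< (toℕ a) _ _ (begin-strict
    toℕ a + offset a y ≡⟨ unwrap-> a y (≰⇒> a>y) ⟩
    n + toℕ y          <⟨ +-monoʳ-< n (≰⇒> a>y) ⟩
    n + toℕ a          ≡⟨ +-comm n _ ⟩
    toℕ a + n          ∎)
    where open ≤-Reasoning

  offset-injective : (s a b : Fin n) → offset s a ≡ offset s b → a ≡ b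
  offset-injective s a b eq with toℕ s ≤? toℕ a | toℕ s ≤? toℕ b
  ... | yes s≤a | yes s≤b = toℕ-injective (begin
    toℕ a              ≡⟨ unwrap-≤ s a s≤a ⟨
    toℕ s + offset s a ≡⟨ cong (toℕ s +_) eq ⟩
    toℕ s + offset s b ≡⟨ unwrap-≤ s b s≤b ⟩
    toℕ b              ∎)
    where open ≡-Reasoning
  ... | no  s>a | no  s>b = toℕ-injective (+-cancelˡ-≡ n _ _ (begin
    n + toℕ a          ≡⟨ unwrap-> s a (≰⇒> s>a) ⟨
    toℕ s + offset s a ≡⟨ cong (toℕ s +_) eq ⟩
    toℕ s + offset s b ≡⟨ unwrap-> s b (≰⇒> s>b) ⟩
    n + toℕ b          ∎))
    where open ≡-Reasoning
  ... | yes s≤a | no  s>b =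
    contradiction (offset-wrapped-≥ s b (≰⇒> s>b))
                  (<⇒≱ (subst (_< n ∸ toℕ s) eq (offset-unwrapped-< s a s≤a)))
  ... | no  s>a | yes s≤b =
    contradiction (offset-wrapped-≥ s a (≰⇒> s>a))
                  (<⇒≱ (subst (_< n ∸ toℕ s) (sym eq) (offset-unwrapped-< s b s≤b)))

  offset-trans : (s a y : Fin n) → offset s a ≤ offset s y →
    offset s a + offset a y ≡ offset s y
  offset-trans s a y h = +-cancelˡ-≡ (toℕ s) _ _ (begin
    toℕ s + (offset s a + offset a y) ≡⟨ +-assoc (toℕ s) _ _ ⟨
    toℕ s + offset s a + offset a y   ≡⟨ unwrapped (toℕ s ≤? toℕ a) (toℕ s ≤? toℕ y) ⟩
    toℕ s + offset s y                ∎)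
    where
    open ≡-Reasoning
    unwrapped : Dec (toℕ s ≤ toℕ a) → Dec (toℕ s ≤ toℕ y) →
         toℕ s + offset s a + offset a y ≡ toℕ s + offset s y
    unwrapped (yes s≤a) (yes s≤y) = begin
      toℕ s + offset s a + offset a y ≡⟨ cong (_+ offset a y) (unwrap-≤ s a s≤a) ⟩
      toℕ a + offset a y              ≡⟨ unwrap-≤ a y a≤y ⟩
      toℕ y                           ≡⟨ unwrap-≤ s y s≤y ⟨
      toℕ s + offset s y              ∎
      where
      a≤y : toℕ a ≤ toℕ y
      a≤y = subst₂ _≤_ (unwrap-≤ s a s≤a) (unwrap-≤ s y s≤y) (+-monoʳ-≤ (toℕ s) h)
    unwrapped (no s>a) (no s>y) = begin
      toℕ s + offset s a + offset a y ≡⟨ cong (_+ offset a y) (unwrap-> s a (≰⇒> s>a)) ⟩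
      n + toℕ a + offset a y          ≡⟨ +-assoc n _ _ ⟩
      n + (toℕ a + offset a y)        ≡⟨ cong (n +_) (unwrap-≤ a y a≤y) ⟩
      n + toℕ y                       ≡⟨ unwrap-> s y (≰⇒> s>y) ⟨
      toℕ s + offset s y              ∎
      where
      a≤y : toℕ a ≤ toℕ y
      a≤y = +-cancelˡ-≤ n _ _
              (subst₂ _≤_ (unwrap-> s a (≰⇒> s>a)) (unwrap-> s y (≰⇒> s>y)) (+-monoʳ-≤ (toℕ s) h))
    unwrapped (yes s≤a) (no s>y) = begin
      toℕ s + offset s a + offset a y ≡⟨ cong (_+ offset a y) (unwrap-≤ s a s≤a) ⟩
      toℕ a + offset a y              ≡⟨ unwrap-> a y (<-≤-trans (≰⇒> s>y) s≤a) ⟩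
      n + toℕ y                       ≡⟨ unwrap-> s y (≰⇒> s>y) ⟨
      toℕ s + offset s y              ∎
    unwrapped (no s>a) (yes s≤y) =
      contradiction (≤-<-trans (offset-wrapped-≥ s a (≰⇒> s>a)) (≤-<-trans h (offset-unwrapped-< s y s≤y))) (n≮n _)

  offset-trans-wrap : (s a y : Fin n) → offset s y < offset s a →
    offset s a + offset a y ≡ offset s y + n
  offset-trans-wrap s a y h = +-cancelˡ-≡ (toℕ s) _ _ (begin
    toℕ s + (offset s a + offset a y) ≡⟨ +-assoc (toℕ s) _ _ ⟨
    toℕ s + offset s a + offset a y   ≡⟨ unwrapped (toℕ s ≤? toℕ a) (toℕ s ≤? toℕ y) ⟩
    toℕ s + offset s y + n            ≡⟨ +-assoc (toℕ s) _ _ ⟩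
    toℕ s + (offset s y + n)          ∎)
    where
    open ≡-Reasoning
    unwrapped : Dec (toℕ s ≤ toℕ a) → Dec (toℕ s ≤ toℕ y) →
         toℕ s + offset s a + offset a y ≡ toℕ s + offset s y + n
    unwrapped (yes s≤a) (yes s≤y) = begin
      toℕ s + offset s a + offset a y ≡⟨ cong (_+ offset a y) (unwrap-≤ s a s≤a) ⟩
      toℕ a + offset a y              ≡⟨ unwrap-> a y y<a ⟩
      n + toℕ y                       ≡⟨ +-comm n _ ⟩
      toℕ y + n                       ≡⟨ cong (_+ n) (unwrap-≤ s y s≤y) ⟨
      toℕ s + offset s y + n          ∎
      where
      y<a : toℕ y < toℕ a
      y<a = subst₂ _<_ (unwrap-≤ s y s≤y) (unwrap-≤ s a s≤a) (+-monoʳ-< (toℕ s) h)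
    unwrapped (no s>a) (no s>y) = begin
      toℕ s + offset s a + offset a y ≡⟨ cong (_+ offset a y) (unwrap-> s a (≰⇒> s>a)) ⟩
      n + toℕ a + offset a y          ≡⟨ +-assoc n _ _ ⟩
      n + (toℕ a + offset a y)        ≡⟨ cong (n +_) (unwrap-> a y y<a) ⟩
      n + (n + toℕ y)                 ≡⟨ +-comm n _ ⟩
      n + toℕ y + n                   ≡⟨ cong (_+ n) (unwrap-> s y (≰⇒> s>y)) ⟨
      toℕ s + offset s y + n          ∎
      where
      y<a : toℕ y < toℕ a
      y<a = +-cancelˡ-< n _ _
              (subst₂ _<_ (unwrap-> s y (≰⇒> s>y)) (unwrap-> s a (≰⇒> s>a)) (+-monoʳ-< (toℕ s) h))
    unwrapped (no s>a) (yes s≤y) = begin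
      toℕ s + offset s a + offset a y ≡⟨ cong (_+ offset a y) (unwrap-> s a (≰⇒> s>a)) ⟩
      n + toℕ a + offset a y          ≡⟨ +-assoc n _ _ ⟩
      n + (toℕ a + offset a y)        ≡⟨ cong (n +_) (unwrap-≤ a y (<⇒≤ (<-≤-trans (≰⇒> s>a) s≤y))) ⟩
      n + toℕ y                       ≡⟨ +-comm n _ ⟩
      toℕ y + n                       ≡⟨ cong (_+ n) (unwrap-≤ s y s≤y) ⟨
      toℕ s + offset s y + n          ∎
    unwrapped (yes s≤a) (no s>y) =
      contradiction (≤-<-trans (offset-wrapped-≥ s y (≰⇒> s>y)) (<-trans h (offset-unwrapped-< s a s≤a))) (n≮n _)

-- Cutting the circle at a base point s0, a point y gets
-- the position P y = offset s0 y ∈ [0, n).  Cyclic notions (segments, their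
-- clockwise order, cyclic intervals) become ordinary order facts about P.
module Positions {n : ℕ} (s0 : Fin n) where

  P : Fin n → ℕ
  P = offset s0

  P-injective : ∀ {a b} → P a ≡ P b → a ≡ b
  P-injective = offset-injective s0 _ _

  P-offset : ∀ a y → P a ≤ P y → P a + offset a y ≡ P y
  P-offset = offset-trans s0

  segment⇒interval : ∀ a ℓ y → P a + ℓ ≤ n → offset a y < ℓ → P a ≤ P y × P y < P a + ℓ
  segment⇒interval a ℓ y fits y∈seg with P a ≤? P y
  ... | yes a≤y = a≤y , subst (_< P a + ℓ) (P-offset a y a≤y) (+-monoʳ-< (P a) y∈seg)
  ... | no  a>y = contradiction
    (subst (_< n) (offset-trans-wrap s0 a y (≰⇒> a>y)) (<-≤-trans (+-monoʳ-< (P a) y∈seg) fits))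
    (m+n≮n (P y) n)

  interval⇒segment : ∀ a ℓ y → P a ≤ P y → P y < P a + ℓ → offset a y < ℓ
  interval⇒segment a ℓ y a≤y y<end = +-cancelˡ-< (P a) _ _ (subst (_< P a + ℓ) (sym (P-offset a y a≤y)) y<end)

  offset<⇒P< : ∀ a y y' → P a ≤ P y → P a ≤ P y' → offset a y < offset a y' → P y < P y'
  offset<⇒P< a y y' a≤y a≤y' lt = subst₂ _<_ (P-offset a y a≤y) (P-offset a y' a≤y') (+-monoʳ-< (P a) lt)

  P<⇒offset< : ∀ a y y' → P a ≤ P y → P a ≤ P y' → P y < P y' → offset a y < offset a y'
  P<⇒offset< a y y' a≤y a≤y' lt =
    +-cancelˡ-< (P a) _ _ (subst₂ _<_ (sym (P-offset a y a≤y)) (sym (P-offset a y' a≤y')) lt)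

  cyclic⇒interval : ∀ u w x → P u ≤ P w → x ∈[ u , w ] → P u ≤ P x × P x ≤ P w
  cyclic⇒interval u w x u≤w x∈ with P u ≤? P x
  ... | yes u≤x = u≤x , subst₂ _≤_ (P-offset u x u≤x) (P-offset u w u≤w) (+-monoʳ-≤ (P u) x∈)
  ... | no  u>x = contradiction
    (subst₂ _≤_ (offset-trans-wrap s0 u x (≰⇒> u>x)) (P-offset u w u≤w) (+-monoʳ-≤ (P u) x∈))
    (<⇒≱ (<-≤-trans (offset<n s0 w) (m≤n+m n (P x))))

divide : ∀ r .{{_ : NonZero r}} i → Σ ℕ λ q → Σ ℕ λ j → j < r × i ≡ q * r + j
divide r i = i / r , i % r , m%n<n i r , trans (m≡m%n+[m/n]*n i r) (+-comm (i % r) _)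

module _ {r : ℕ} where

  quotient<⇒< : ∀ q q' j j' → j < r → q < q' → q * r + j < q' * r + j'
  quotient<⇒< q q' j j' j<r q<q' = begin-strict
    q * r + j   <⟨ +-monoʳ-< (q * r) j<r ⟩
    q * r + r   ≡⟨ +-comm (q * r) r ⟩
    suc q * r   ≤⟨ *-monoˡ-≤ r q<q' ⟩
    q' * r      ≤⟨ m≤m+n (q' * r) j' ⟩
    q' * r + j' ∎
    where open ≤-Reasoning

  quotient-< : ∀ q q' j j' → j' ≤ j → q * r + j < q' * r + j' → q < q'
  quotient-< q q' j j' j'≤j lt =
    *-cancelʳ-< r q q' (+-cancelʳ-< j' (q * r) (q' * r) (≤-<-trans (+-monoʳ-≤ (q * r) j'≤j) lt))

  quotient-≤ : ∀ q q' j j' → j' < r → q * r + j < q' * r + j' → q ≤ q'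
  quotient-≤ q q' j j' j'<r lt with q ≤? q'
  ... | yes q≤q' = q≤q'
  ... | no  q>q' = contradiction lt (<⇒≯ (quotient<⇒< q' q j' j j'<r (≰⇒> q>q')))

  quotient-unique : ∀ q q' j j' → j < r → j' < r → q * r + j ≡ q' * r + j' → q ≡ q' × j ≡ j'
  quotient-unique q q' j j' j<r j'<r eq with <-cmp q q'
  ... | tri< q<q' _ _ = contradiction eq (<⇒≢ (quotient<⇒< q q' j j' j<r q<q'))
  ... | tri> _ _ q>q' = contradiction (sym eq) (<⇒≢ (quotient<⇒< q' q j' j j'<r q>q'))
  ... | tri≈ _ refl _ = refl , +-cancelˡ-≡ (q * r) j j' eq

update : {A : Set} → (ℕ → A) → ℕ → A → ℕ → A
update f i y j with j ≟ i
... | yes _ = y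
... | no  _ = f j

update-at : ∀ {A : Set} (f : ℕ → A) i y → update f i y i ≡ y
update-at f i y with i ≟ i
... | yes _   = refl
... | no  i≢i = contradiction refl i≢i

update-other : ∀ {A : Set} (f : ℕ → A) i y j → j ≢ i → update f i y j ≡ f j
update-other f i y j j≢i with j ≟ i
... | yes j≡i = contradiction j≡i j≢i
... | no  _   = refl

snoc-at : ∀ {n} (v : ℕ → Fin n) m x {i} → i ≡ m → snoc v m x i ≡ x
snoc-at v m x {i} i≡m with i ≟ m
... | yes _   = refl
... | no  i≢m = contradiction i≡m i≢m

snoc-below : ∀ {n} (v : ℕ → Fin n) m x {i} → i < m → snoc v m x i ≡ v i
snoc-below v m x {i} i<m with i ≟ m
... | yes i≡m = contradiction i≡m (<⇒≢ i<m)
... | no  _   = refl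

data Around (a : ℕ) : ℕ → Set where
  at-a      : Around a a
  at-next   : Around a (suc a)
  elsewhere : ∀ {j} → j ≢ a → j ≢ suc a → Around a j

around : ∀ a j → Around a j
around a j with j ≟ a | j ≟ suc a
... | yes refl | _        = at-a
... | no  _    | yes refl = at-next
... | no  j≢a  | no j≢a+1 = elsewhere j≢a j≢a+1

below-last : ∀ {j r} → j < r → j < r ∸ 1 ⊎ j ≡ r ∸ 1
below-last {r = suc r} j<r = m<1+n⇒m<n∨m≡n j<r

last<r : ∀ {j r} → j < r → r ∸ 1 < r
last<r {r = suc r} _ = n<1+n r

suc-pred-of : ∀ {j r} → j < r → suc (r ∸ 1) ≡ r
suc-pred-of {r = suc r} _ = refl

even-0 : Even 0
even-0 = divides 0 refl

even-or-next : ∀ j → Even j ⊎ Even (suc j)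
even-or-next zero    = inj₁ even-0
even-or-next (suc j) with even-or-next j
... | inj₁ even-j       = inj₂ (∣m∣n⇒∣m+n (divides 1 refl) even-j)
... | inj₂ even-suc-j   = inj₁ even-suc-j

not-both-even : ∀ {j} → Even j → ¬ Even (suc j)
not-both-even {j} even-j even-sj = one-odd (∣m+n∣m⇒∣n (subst Even (+-comm 1 j) even-sj) even-j)
  where
  one-odd : ¬ Even 1
  one-odd (divides (suc q) ())

even-not-last : ∀ {j r} → Even r → Even j → j < r → suc j < r
even-not-last even-r even-j j<r with m≤n⇒m<n∨m≡n j<r
... | inj₁ 1+j<r = 1+j<r
... | inj₂ 1+j≡r = contradiction (subst Even (sym 1+j≡r) even-r) (not-both-even even-j)

odd-successor : ∀ {j} → ¬ Even j → Σ ℕ λ a → j ≡ suc a × Even a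
odd-successor {zero}  odd = contradiction even-0 odd
odd-successor {suc a} odd with even-or-next a
... | inj₁ even-a   = a , refl , even-a
... | inj₂ even-1+a = contradiction even-1+a odd

even-remainder : ∀ {r} q j → Even r → Even (q * r + j) → Even j
even-remainder q j even-r even = ∣m+n∣m⇒∣n even (∣n⇒∣m*n q even-r)

even-add-multiple : ∀ {r} q j → Even r → Even j → Even (q * r + j)
even-add-multiple q j even-r even-j = ∣m∣n⇒∣m+n (∣n⇒∣m*n q even-r) even-j

-- A frame is the linear picture of the segments I_0 ≺ … ≺ I_{r-1} of
-- a zigzag: with the cut at s0 = first 0, segment I_j is the interval of
-- positions [P (first j), end j), and these intervals are disjoint and
-- increasing inside [0, n).
module Frames {n : ℕ} (r : ℕ) (s0 : Fin n) where
  open Positions s0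

  record Frame : Set where
    field
      first   : ℕ → Fin n
      len     : ℕ → ℕ
      first-0 : first 0 ≡ s0
      ordered : ∀ j → suc j < r → P (first j) + len j ≤ P (first (suc j))
      wrap    : P (first (r ∸ 1)) + len (r ∸ 1) ≤ n

    end : ℕ → ℕ
    end j = P (first j) + len j

    end≤first : ∀ j j' → j < j' → j' < r → end j ≤ P (first j')
    end≤first j (suc j') j<1+j' 1+j'<r with m<1+n⇒m<n∨m≡n j<1+j'
    ... | inj₂ refl = ordered j 1+j'<r
    ... | inj₁ j<j' = ≤-trans (end≤first j j' j<j' (<-trans (n<1+n j') 1+j'<r))
                              (≤-trans (m≤m+n _ (len j')) (ordered j' 1+j'<r))

    end≤n : ∀ j → j < r → end j ≤ n
    end≤n j j<r with below-last j<r
    ... | inj₂ refl  = wrap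
    ... | inj₁ j<r-1 = ≤-trans (end≤first j (r ∸ 1) j<r-1 (last<r j<r)) (≤-trans (m≤m+n _ _) wrap)

  record InFrame (F : Frame) (N : ℕ) (w : ℕ → Fin n) : Set where
    open Frame F
    field
      above-first : ∀ q j → j < r → q * r + j < N → P (first j) ≤ P (w (q * r + j))
      below-end   : ∀ q j → j < r → q * r + j < N → P (w (q * r + j)) < end j

  record Alternating (N : ℕ) (w : ℕ → Fin n) : Set where
    field
      even-up  : ∀ q j → j < r → Even j → suc q * r + j < N →
                   P (w (q * r + j)) < P (w (suc q * r + j))
      odd-down : ∀ q j → j < r → ¬ Even j → suc q * r + j < N →
                   P (w (suc q * r + j)) < P (w (q * r + j))

  index-step : ∀ q j → q * r + j ≤ suc q * r + j
  index-step q j = subst (q * r + j ≤_) (sym (+-assoc r (q * r) j)) (m≤n+m _ r)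

  module AlternatingChains {N : ℕ} {w : ℕ → Fin n} (alt : Alternating N w) where
    open Alternating alt

    even-chain< : ∀ j → j < r → Even j → ∀ q q' → q < q' → q' * r + j < N →
                  P (w (q * r + j)) < P (w (q' * r + j))
    even-chain< j j<r even q (suc q') q<1+q' bound with m<1+n⇒m<n∨m≡n q<1+q'
    ... | inj₂ refl = even-up q j j<r even bound
    ... | inj₁ q<q' = <-trans (even-chain< j j<r even q q' q<q' (≤-<-trans (index-step q' j) bound))
                              (even-up q' j j<r even bound)

    odd-chain< : ∀ j → j < r → ¬ Even j → ∀ q q' → q < q' → q' * r + j < N →
                 P (w (q' * r + j)) < P (w (q * r + j))
    odd-chain< j j<r odd q (suc q') q<1+q' bound with m<1+n⇒m<n∨m≡n q<1+q'
    ... | inj₂ refl = odd-down q j j<r odd bound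
    ... | inj₁ q<q' = <-trans (odd-down q' j j<r odd bound)
                              (odd-chain< j j<r odd q q' q<q' (≤-<-trans (index-step q' j) bound))

    even-chain : ∀ j → j < r → Even j → ∀ q q' → q ≤ q' → q' * r + j < N →
                 P (w (q * r + j)) ≤ P (w (q' * r + j))
    even-chain j j<r even q q' q≤q' bound with m≤n⇒m<n∨m≡n q≤q'
    ... | inj₁ q<q' = <⇒≤ (even-chain< j j<r even q q' q<q' bound)
    ... | inj₂ refl = ≤-refl

    odd-chain : ∀ j → j < r → ¬ Even j → ∀ q q' → q ≤ q' → q' * r + j < N →
                P (w (q' * r + j)) ≤ P (w (q * r + j))
    odd-chain j j<r odd q q' q≤q' bound with m≤n⇒m<n∨m≡n q≤q'
    ... | inj₁ q<q' = <⇒≤ (odd-chain< j j<r odd q q' q<q' bound)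
    ... | inj₂ refl = ≤-refl

  module _ {F : Frame} {N : ℕ} {w : ℕ → Fin n} (inF : InFrame F N w) (alt : Alternating N w) where
    open Frame F
    open InFrame inF
    open AlternatingChains alt

    separated : ∀ q q' j j' → j < j' → j' < r → q * r + j < N → q' * r + j' < N →
                P (w (q * r + j)) < P (w (q' * r + j'))
    separated q q' j j' j<j' j'<r b b' =
      <-≤-trans (below-end q j (<-trans j<j' j'<r) b)
                (≤-trans (end≤first j j' j<j' j'<r) (above-first q' j' j'<r b'))

    -- Hence the terms are distinct: different classes are separated, and
    -- each class is strictly monotone.
    frame-distinct : {{_ : NonZero r}} → ∀ i i' → i < N → i' < N → w i ≡ w i' → i ≡ i'
    frame-distinct i i' i<N i'<N eq with divide r i | divide r i'
    ... | q , j , j<r , refl | q' , j' , j'<r , refl with <-cmp j j'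
    ... | tri< j<j' _ _ = contradiction (cong P eq) (<⇒≢ (separated q q' j j' j<j' j'<r i<N i'<N))
    ... | tri> _ _ j>j' = contradiction (cong P (sym eq)) (<⇒≢ (separated q' q j' j j>j' j<r i'<N i<N))
    ... | tri≈ _ refl _ with <-cmp q q' | 2 ∣? j
    ...   | tri≈ _ refl _ | _ = refl
    ...   | tri< q<q' _ _ | yes even = contradiction (cong P eq) (<⇒≢ (even-chain< j j<r even q q' q<q' i'<N))
    ...   | tri> _ _ q>q' | yes even = contradiction (cong P (sym eq)) (<⇒≢ (even-chain< j j<r even q' q q>q' i<N))
    ...   | tri< q<q' _ _ | no  odd  = contradiction (cong P (sym eq)) (<⇒≢ (odd-chain< j j<r odd q q' q<q' i'<N))
    ...   | tri> _ _ q>q' | no  odd  = contradiction (cong P eq) (<⇒≢ (odd-chain< j j<r odd q' q q>q' i<N))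

  frame⇒zigzag : {{_ : NonZero r}} (H : CGH n r) (k : ℕ) (w : ℕ → Fin n) (F : Frame) →
    InFrame F (k + r ∸ 1) w → Alternating (k + r ∸ 1) w →
    (∀ i → i < k → Edge H (block w i r)) → IsZigzag H k w
  frame⇒zigzag H k w F inF alt edges = record
    { distinct = frame-distinct inF alt
    ; edges    = edges
    ; start    = first
    ; len      = len
    ; ordered  = λ j 1+j<r → subst (λ s → offset s (first j) + len j ≤ offset s (first (suc j)))
                                   (sym first-0) (ordered j 1+j<r)
    ; wrap     = subst (λ s → offset s (first (r ∸ 1)) + len (r ∸ 1) ≤ n) (sym first-0) wrap
    ; inSeg    = λ q j j<r b → interval⇒segment (first j) (len j) _ (above-first q j j<r b) (below-end q j j<r b)
    ; monoEven = λ q j j<r even b → P<⇒offset< (first j) _ _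
                  (above-first q j j<r (≤-<-trans (index-step q j) b)) (above-first (suc q) j j<r b)
                  (even-up q j j<r even b)
    ; monoOdd  = λ q j j<r odd b → P<⇒offset< (first j) _ _
                  (above-first (suc q) j j<r b) (above-first q j j<r (≤-<-trans (index-step q j) b))
                  (odd-down q j j<r odd b)
    }
    where
    open Frame F
    open InFrame inF
    open Alternating alt

  Continues : ℕ → Fin n → Fin n → Set
  Continues j y x = (Even j → P y < P x) × (¬ Even j → P x < P y)

  -- Moving the boundary between consecutive segments I_a and I_{a+1}: I_a now
  -- ends at position e and I_{a+1} starts at the point b, keeping its end.
  module MoveBoundary (F : Frame) (a : ℕ) (a+1<r : suc a < r) (e : ℕ) (b : Fin n)
    (first≤e : P (Frame.first F a) ≤ e) (e≤b : e ≤ P b) (b≤end : P b ≤ Frame.end F (suc a)) where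
    open Frame F

    first′ : ℕ → Fin n
    first′ = update first (suc a) b

    len′ : ℕ → ℕ
    len′ = update (update len (suc a) (end (suc a) ∸ P b)) a (e ∸ P (first a))

    end′ : ℕ → ℕ
    end′ j = P (first′ j) + len′ j

    first′-other : ∀ j → j ≢ suc a → first′ j ≡ first j
    first′-other = update-other first (suc a) b

    first′-next : first′ (suc a) ≡ b
    first′-next = update-at first (suc a) b

    end′-a : end′ a ≡ e
    end′-a = begin
      P (first′ a) + len′ a         ≡⟨ cong₂ (λ s ℓ → P s + ℓ) (first′-other a (1+n≢n ∘ sym)) (update-at _ a _) ⟩
      P (first a) + (e ∸ P (first a)) ≡⟨ m+[n∸m]≡n first≤e ⟩
      e                             ∎
      where open ≡-Reasoning

    end′-next : end′ (suc a) ≡ end (suc a)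
    end′-next = begin
      P (first′ (suc a)) + len′ (suc a)  ≡⟨ cong₂ (λ s ℓ → P s + ℓ) first′-next
                                            (trans (update-other _ a _ (suc a) 1+n≢n) (update-at len (suc a) _)) ⟩
      P b + (end (suc a) ∸ P b)          ≡⟨ m+[n∸m]≡n b≤end ⟩
      end (suc a)                        ∎
      where open ≡-Reasoning

    end′-other : ∀ j → j ≢ a → j ≢ suc a → end′ j ≡ end j
    end′-other j j≢a j≢a+1 = cong₂ (λ s ℓ → P s + ℓ) (first′-other j j≢a+1)
      (trans (update-other _ a _ j j≢a) (update-other len (suc a) _ j j≢a+1))

    ordered′ : ∀ j → suc j < r → end′ j ≤ P (first′ (suc j))
    ordered′ j 1+j<r with around a j
    ... | at-a       = subst₂ _≤_ (sym end′-a) (cong P (sym first′-next)) e≤b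
    ... | at-next    = subst₂ _≤_ (sym end′-next) (cong P (sym (first′-other (suc (suc a)) 1+n≢n)))
                                 (ordered (suc a) 1+j<r)
    ... | elsewhere j≢a j≢a+1 = subst₂ _≤_ (sym (end′-other j j≢a j≢a+1))
                                 (cong P (sym (first′-other (suc j) (j≢a ∘ suc-injective)))) (ordered j 1+j<r)

    wrap′ : end′ (r ∸ 1) ≤ n
    wrap′ = by-cases (r ∸ 1 ≟ suc a)
      where
      by-cases : Dec (r ∸ 1 ≡ suc a) → end′ (r ∸ 1) ≤ n
      by-cases (yes last≡a+1) = subst (_≤ n) (sym (trans (cong end′ last≡a+1) end′-next)) (end≤n (suc a) a+1<r)
      by-cases (no  last≢a+1) = subst (_≤ n) (sym (end′-other (r ∸ 1) last≢a last≢a+1)) wrap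
        where
        last≢a : r ∸ 1 ≢ a
        last≢a last≡a = <⇒≢ (≤-trans a+1<r (≤-reflexive (sym (suc-pred-of a+1<r)))) (cong suc (sym last≡a))

    moved : Frame
    moved = record
      { first   = first′
      ; len     = len′
      ; first-0 = trans (first′-other 0 0≢1+n) first-0
      ; ordered = ordered′
      ; wrap    = wrap′
      }

    moved-inFrame : ∀ {N w} → InFrame F N w →
      (∀ q → q * r + a < N → P (w (q * r + a)) < e) →
      (∀ q → q * r + suc a < N → P b ≤ P (w (q * r + suc a))) →
      InFrame moved N w
    moved-inFrame {N} {w} inF below-e above-b = record { above-first = above-first′ ; below-end = below-end′ }
      where
      open InFrame inF
      above-first′ : ∀ q j → j < r → q * r + j < N → P (first′ j) ≤ P (w (q * r + j))
      above-first′ q j j<r i<N with around a j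
      ... | at-a              = subst (_≤ _) (cong P (sym (first′-other a (1+n≢n ∘ sym)))) (above-first q a j<r i<N)
      ... | at-next           = subst (_≤ _) (cong P (sym first′-next)) (above-b q i<N)
      ... | elsewhere _ j≢a+1 = subst (_≤ _) (cong P (sym (first′-other j j≢a+1))) (above-first q j j<r i<N)
      below-end′ : ∀ q j → j < r → q * r + j < N → P (w (q * r + j)) < end′ j
      below-end′ q j j<r i<N with around a j
      ... | at-a                = subst (P (w (q * r + a)) <_) (sym end′-a) (below-e q i<N)
      ... | at-next             = subst (P (w (q * r + suc a)) <_) (sym end′-next) (below-end q j j<r i<N)
      ... | elsewhere j≢a j≢a+1 = subst (P (w (q * r + j)) <_) (sym (end′-other j j≢a j≢a+1)) (below-end q j j<r i<N)

  module Append {N : ℕ} {w : ℕ → Fin n} (q0 j0 : ℕ) (j0<r : j0 < r) (N≡ : N ≡ suc q0 * r + j0)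
                (x : Fin n) where

    previous<N : q0 * r + j0 < N
    previous<N = subst (q0 * r + j0 <_) (sym N≡) (quotient<⇒< q0 (suc q0) j0 j0 j0<r (n<1+n q0))

    P-old : ∀ {i} → i < N → P (snoc w N x i) ≡ P (w i)
    P-old i<N = cong P (snoc-below w N x i<N)

    P-new : ∀ {i} → i ≡ N → P (snoc w N x i) ≡ P x
    P-new i≡N = cong P (snoc-at w N x i≡N)

    new-index : ∀ q j → j < r → q * r + j ≡ N → q ≡ suc q0 × j ≡ j0
    new-index q j j<r i≡N = quotient-unique q (suc q0) j j0 j<r j0<r (trans i≡N N≡)

    appended-inFrame : ∀ {F} → InFrame F N w →
      P (Frame.first F j0) ≤ P x → P x < Frame.end F j0 → InFrame F (suc N) (snoc w N x)
    appended-inFrame {F} inF x-above x-below = record { above-first = above-first′ ; below-end = below-end′ }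
      where
      open Frame F
      open InFrame inF
      above-first′ : ∀ q j → j < r → q * r + j < suc N → P (first j) ≤ P (snoc w N x (q * r + j))
      above-first′ q j j<r i<1+N with m<1+n⇒m<n∨m≡n i<1+N
      ... | inj₁ i<N = subst (P (first j) ≤_) (sym (P-old i<N)) (above-first q j j<r i<N)
      ... | inj₂ i≡N with new-index q j j<r i≡N
      ...   | refl , refl = subst (P (first j0) ≤_) (sym (P-new i≡N)) x-above
      below-end′ : ∀ q j → j < r → q * r + j < suc N → P (snoc w N x (q * r + j)) < end j
      below-end′ q j j<r i<1+N with m<1+n⇒m<n∨m≡n i<1+N
      ... | inj₁ i<N = subst (_< end j) (sym (P-old i<N)) (below-end q j j<r i<N)
      ... | inj₂ i≡N with new-index q j j<r i≡N
      ...   | refl , refl = subst (_< end j0) (sym (P-new i≡N)) x-below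

    appended-alternating : Alternating N w → Continues j0 (w (q0 * r + j0)) x →
      Alternating (suc N) (snoc w N x)
    appended-alternating alt (up , down) = record { even-up = even-up′ ; odd-down = odd-down′ }
      where
      open Alternating alt
      even-up′ : ∀ q j → j < r → Even j → suc q * r + j < suc N →
                 P (snoc w N x (q * r + j)) < P (snoc w N x (suc q * r + j))
      even-up′ q j j<r even i<1+N with m<1+n⇒m<n∨m≡n i<1+N
      ... | inj₁ i<N = subst₂ _<_ (sym (P-old (≤-<-trans (index-step q j) i<N))) (sym (P-old i<N))
                         (even-up q j j<r even i<N)
      ... | inj₂ i≡N with new-index (suc q) j j<r i≡N
      ...   | refl , refl = subst₂ _<_ (sym (P-old previous<N)) (sym (P-new i≡N)) (up even)
      odd-down′ : ∀ q j → j < r → ¬ Even j → suc q * r + j < suc N →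
                  P (snoc w N x (suc q * r + j)) < P (snoc w N x (q * r + j))
      odd-down′ q j j<r odd i<1+N with m<1+n⇒m<n∨m≡n i<1+N
      ... | inj₁ i<N = subst₂ _<_ (sym (P-old i<N)) (sym (P-old (≤-<-trans (index-step q j) i<N)))
                         (odd-down q j j<r odd i<N)
      ... | inj₂ i≡N with new-index (suc q) j j<r i≡N
      ...   | refl , refl = subst₂ _<_ (sym (P-new i≡N)) (sym (P-old previous<N)) (down odd)

extended-edges : ∀ {n r} (H : CGH n (suc r)) k (v : ℕ → Fin n) m x → k + r ≡ m →
  (∀ i → i < k → Edge H (block v i (suc r))) → Edge H (⁅ x ⁆ ∪ block v k r) →
  ∀ i → i < suc k → Edge H (block (snoc v m x) i (suc r))
extended-edges {r = r} H k v m x k+r≡m old-edge new-edge i i<1+k with m<1+n⇒m<n∨m≡n i<1+k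
... | inj₁ i<k = subst (Edge H) (block-cong v (snoc v m x) i (suc r) unchanged) (old-edge i i<k)
  where
  unchanged : ∀ t → t < suc r → v (i + t) ≡ snoc v m x (i + t)
  unchanged t t<1+r = sym (snoc-below v m x (subst (i + t <_) k+r≡m (+-mono-<-≤ i<k (s≤s⁻¹ t<1+r))))
... | inj₂ refl = subst (Edge H) (sym last-block) new-edge
  where
  open ≡-Reasoning
  last-block : block (snoc v m x) k (suc r) ≡ ⁅ x ⁆ ∪ block v k r
  last-block = begin
    block (snoc v m x) k (suc r)                    ≡⟨ block-snoc (snoc v m x) k r ⟩
    block (snoc v m x) k r ∪ ⁅ snoc v m x (k + r) ⁆ ≡⟨ cong₂ _∪_ (block-cong (snoc v m x) v k r λ t t<r →
                                                          snoc-below v m x (subst (k + t <_) k+r≡m (+-monoʳ-< k t<r)))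
                                                       (cong ⁅_⁆ (snoc-at v m x k+r≡m)) ⟩
    block v k r ∪ ⁅ x ⁆                             ≡⟨ ∪-comm _ _ ⟩
    ⁅ x ⁆ ∪ block v k r                             ∎

module ZigzagFrame {n r : ℕ} {H : CGH n r} {k : ℕ} {v : ℕ → Fin n} (Z : IsZigzag H k v) where
  open IsZigzag Z
  open Positions (start 0)
  open Frames r (start 0)

  frame : Frame
  frame = record { first = start ; len = len ; first-0 = refl ; ordered = ordered ; wrap = wrap }

  in-interval : ∀ q j → j < r → q * r + j < k + r ∸ 1 →
    P (start j) ≤ P (v (q * r + j)) × P (v (q * r + j)) < P (start j) + len j
  in-interval q j j<r b = segment⇒interval (start j) (len j) _ (Frame.end≤n frame j j<r) (inSeg q j j<r b)

  inFrame : InFrame frame (k + r ∸ 1) v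
  inFrame = record
    { above-first = λ q j j<r b → proj₁ (in-interval q j j<r b)
    ; below-end   = λ q j j<r b → proj₂ (in-interval q j j<r b)
    }

  alternating : Alternating (k + r ∸ 1) v
  alternating = record
    { even-up  = λ q j j<r even b → offset<⇒P< (start j) _ _
                   (proj₁ (in-interval q j j<r (≤-<-trans (index-step q j) b))) (proj₁ (in-interval (suc q) j j<r b))
                   (monoEven q j j<r even b)
    ; odd-down = λ q j j<r odd b → offset<⇒P< (start j) _ _
                   (proj₁ (in-interval (suc q) j j<r b)) (proj₁ (in-interval q j j<r (≤-<-trans (index-step q j) b)))
                   (monoOdd q j j<r odd b)
    }

next-quotient : ∀ q r j → q * r + j + r ≡ suc q * r + j
next-quotient = solve-∀

-- The proposition, for r = r′ + 2 and k = k′ + 1.  The new point x gets index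
-- m = k′ + r; writing k′ = q0 r + j0, this is m = (q0 + 1) r + j0, so x joins
-- the residue class j0 of v_{k-1} right after it.
module Extension {n r′ k′ : ℕ} (H : CGH n (2 + r′)) (even-r : Even (2 + r′))
  {v : ℕ → Fin n} (Z : IsZigzag H (suc k′) v) (x : Fin n) (x∈X : x ∈X[ H , suc k′ , v ]) where

  r : ℕ
  r = 2 + r′

  m : ℕ
  m = k′ + r

  open IsZigzag Z using (start; edges)
  open Positions (start 0)
  open Frames r (start 0)
  open ZigzagFrame Z using (frame; inFrame; alternating)
  open Frame frame
  open InFrame inFrame
  open AlternatingChains alternating

  division : Σ ℕ λ q → Σ ℕ λ j → j < r × k′ ≡ q * r + j
  division = divide r k′

  q0 j0 : ℕ
  q0 = proj₁ division
  j0 = proj₁ (proj₂ division)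

  j0<r : j0 < r
  j0<r = proj₁ (proj₂ (proj₂ division))

  k′≡ : k′ ≡ q0 * r + j0
  k′≡ = proj₂ (proj₂ (proj₂ division))

  m≡ : m ≡ suc q0 * r + j0
  m≡ = trans (cong (_+ r) k′≡) (next-quotient q0 r j0)

  k′<m : k′ < m
  k′<m = m<m+n k′ (s≤s z≤n)

  located : ∀ {i} q j → i ≡ q * r + j → j < r → i < m → P (first j) ≤ P (v i) × P (v i) < end j
  located q j refl j<r i<m = above-first q j j<r i<m , below-end q j j<r i<m

  x≢u : x ≢ v k′
  x≢u = proj₁ (proj₂ x∈X)

  x-edge : Edge H (⁅ x ⁆ ∪ block v (suc k′) (suc r′))
  x-edge = proj₂ (proj₂ x∈X)

  -- x is none of v_k, …, v_{k+r-2}, since x completes them to an r-edge.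
  x≢later : ∀ t → t < suc r′ → x ≢ v (suc k′ + t)
  x≢later = edge-avoids-block H x v (suc k′) x-edge

  -- What each case has to provide: a frame holding the old terms, with x in
  -- segment I_{j0} and continuing class j0 after v_{k-1}.
  record Placement : Set where
    field
      frame′    : Frame
      inFrame′  : InFrame frame′ m v
      x-above   : P (Frame.first frame′ j0) ≤ P x
      x-below   : P x < Frame.end frame′ j0
      continues : Continues j0 (v k′) x

  placement⇒zigzag : Placement → IsZigzag H (suc k′ + 1) (snoc v m x)
  placement⇒zigzag p =
    frame⇒zigzag H (suc k′ + 1) (snoc v m x) frame′
      (subst (λ N → InFrame frame′ N (snoc v m x)) new-length (appended-inFrame inFrame′ x-above x-below))
      (subst (λ N → Alternating N (snoc v m x)) new-length
        (appended-alternating alternating (subst (λ i → Continues j0 (v i) x) k′≡ continues)))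
      (λ i i<k+1 → extended-edges H (suc k′) v m x (sym (+-suc k′ (suc r′))) edges x-edge i
                     (subst (i <_) (+-comm (suc k′) 1) i<k+1))
    where
    open Placement p
    open Append {m} {v} q0 j0 j0<r m≡ x
    new-length : suc m ≡ suc k′ + 1 + r ∸ 1
    new-length = sym (trans (+-assoc k′ 1 r) (+-suc k′ r))

  -- k odd: then k - 1 and j0 are even, v_k is the last term of class j0 + 1,
  -- and x ∈ [v_{k-1}, v_k].  Segment I_{j0} is extended up to x, and I_{j0+1}
  -- now starts at v_k.
  module OddCase (odd-k : ¬ Even (suc k′)) (x∈I : x ∈[ v k′ , v (suc k′) ]) where
    a : ℕ
    a = j0

    even-a : Even a
    even-a with even-or-next k′
    ... | inj₁ even-k′ = even-remainder q0 j0 even-r (subst Even k′≡ even-k′)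
    ... | inj₂ even-k  = contradiction even-k odd-k

    a+1<r : suc a < r
    a+1<r = even-not-last even-r even-a j0<r

    k≡ : suc k′ ≡ q0 * r + suc a
    k≡ = trans (cong suc k′≡) (sym (+-suc (q0 * r) a))

    k<m : suc k′ < m
    k<m = subst (suc k′ <_) (sym (+-suc k′ (suc r′))) (s≤s (m<m+n k′ (s≤s z≤n)))

    u-located : P (first a) ≤ P (v k′) × P (v k′) < end a
    u-located = located q0 a k′≡ j0<r k′<m

    next-located : P (first (suc a)) ≤ P (v (suc k′)) × P (v (suc k′)) < end (suc a)
    next-located = located q0 (suc a) k≡ a+1<r k<m

    u<next : P (v k′) < P (v (suc k′))
    u<next = <-≤-trans (proj₂ u-located) (≤-trans (ordered a a+1<r) (proj₁ next-located))

    x-between : P (v k′) ≤ P x × P x ≤ P (v (suc k′))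
    x-between = cyclic⇒interval _ _ x (<⇒≤ u<next) x∈I

    u<x : P (v k′) < P x
    u<x = ≤∧≢⇒< (proj₁ x-between) (λ eq → x≢u (P-injective (sym eq)))

    x<next : P x < P (v (suc k′))
    x<next = ≤∧≢⇒< (proj₂ x-between)
      (λ eq → x≢later 0 (s≤s z≤n) (trans (P-injective eq) (cong v (sym (+-identityʳ (suc k′))))))

    first≤x+1 : P (first a) ≤ suc (P x)
    first≤x+1 = ≤-trans (proj₁ u-located) (<⇒≤ (m<n⇒m<1+n u<x))

    open MoveBoundary frame a a+1<r (suc (P x)) (v (suc k′)) first≤x+1 x<next (<⇒≤ (proj₂ next-located))

    -- class a is increasing and ends with v_{k-1}
    class-below : ∀ q → q * r + a < m → P (v (q * r + a)) < suc (P x)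
    class-below q i<m = s≤s (≤-trans (subst (λ i → P (v (q * r + a)) ≤ P (v i)) (sym k′≡)
      (even-chain a j0<r even-a q q0 q≤q0 (subst (_< m) k′≡ k′<m))) (<⇒≤ u<x))
      where
      q≤q0 : q ≤ q0
      q≤q0 = s≤s⁻¹ (quotient-< q (suc q0) a a ≤-refl (subst (q * r + a <_) m≡ i<m))

    -- class a + 1 is decreasing and ends with v_k
    class-above : ∀ q → q * r + suc a < m → P (v (suc k′)) ≤ P (v (q * r + suc a))
    class-above q i<m = subst (λ i → P (v i) ≤ P (v (q * r + suc a))) (sym k≡)
      (odd-chain (suc a) a+1<r (not-both-even even-a) q q0 q≤q0 (subst (_< m) k≡ k<m))
      where
      q≤q0 : q ≤ q0
      q≤q0 = s≤s⁻¹ (quotient-< q (suc q0) (suc a) a (n≤1+n a) (subst (q * r + suc a <_) m≡ i<m))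

    placement : Placement
    placement = record
      { frame′    = moved
      ; inFrame′  = moved-inFrame inFrame class-below class-above
      ; x-above   = subst (_≤ P x) (cong P (sym (first′-other a (1+n≢n ∘ sym))))
                      (≤-trans (proj₁ u-located) (<⇒≤ u<x))
      ; x-below   = subst (P x <_) (sym end′-a) (n<1+n (P x))
      ; continues = (λ _ → u<x) , (λ odd-a → contradiction even-a odd-a)
      }

  -- k even: then j0 = a + 1 is odd, v_{k+r-2} is the last term of class a,
  -- and x ∈ [v_{k+r-2}, v_{k-1}].  Segment I_a is cut just after v_{k+r-2},
  -- and I_{a+1} now starts at x.
  module EvenCase (even-k : Even (suc k′)) (x∈I : x ∈[ v (m ∸ 1) , v k′ ]) where
    odd-j0 : ¬ Even j0
    odd-j0 even-j0 = not-both-even (subst Even (sym k′≡) (even-add-multiple q0 j0 even-r even-j0)) even-k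

    a : ℕ
    a = proj₁ (odd-successor odd-j0)

    j0≡ : j0 ≡ suc a
    j0≡ = proj₁ (proj₂ (odd-successor odd-j0))

    even-a : Even a
    even-a = proj₂ (proj₂ (odd-successor odd-j0))

    a+1<r : suc a < r
    a+1<r = subst (_< r) j0≡ j0<r

    k′≡′ : k′ ≡ q0 * r + suc a
    k′≡′ = trans k′≡ (cong (q0 * r +_) j0≡)

    m≡′ : m ≡ suc (suc q0 * r + a)
    m≡′ = trans m≡ (trans (cong (suc q0 * r +_) j0≡) (+-suc (suc q0 * r) a))

    last≡ : m ∸ 1 ≡ suc q0 * r + a
    last≡ = cong (_∸ 1) m≡′

    last<m : m ∸ 1 < m
    last<m = subst₂ _<_ (sym last≡) (sym m≡′) (n<1+n _)

    z-located : P (first a) ≤ P (v (m ∸ 1)) × P (v (m ∸ 1)) < end a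
    z-located = located (suc q0) a last≡ (<-trans (n<1+n a) a+1<r) last<m

    u-located : P (first (suc a)) ≤ P (v k′) × P (v k′) < end (suc a)
    u-located = located q0 (suc a) k′≡′ a+1<r k′<m

    z<u : P (v (m ∸ 1)) < P (v k′)
    z<u = <-≤-trans (proj₂ z-located) (≤-trans (ordered a a+1<r) (proj₁ u-located))

    x-between : P (v (m ∸ 1)) ≤ P x × P x ≤ P (v k′)
    x-between = cyclic⇒interval _ _ x (<⇒≤ z<u) x∈I

    z<x : P (v (m ∸ 1)) < P x
    z<x = ≤∧≢⇒< (proj₁ x-between)
      (λ eq → x≢later r′ (n<1+n r′) (trans (P-injective (sym eq)) (cong v last≡later)))
      where
      last≡later : m ∸ 1 ≡ suc k′ + r′
      last≡later = trans (cong (_∸ 1) (+-suc k′ (suc r′))) (+-suc k′ r′)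

    x<u : P x < P (v k′)
    x<u = ≤∧≢⇒< (proj₂ x-between) (λ eq → x≢u (P-injective eq))

    first≤z+1 : P (first a) ≤ suc (P (v (m ∸ 1)))
    first≤z+1 = m≤n⇒m≤1+n (proj₁ z-located)

    open MoveBoundary frame a a+1<r (suc (P (v (m ∸ 1)))) x first≤z+1 z<x (<⇒≤ (<-trans x<u (proj₂ u-located)))

    -- class a is increasing and ends with v_{k+r-2}
    class-below : ∀ q → q * r + a < m → P (v (q * r + a)) < suc (P (v (m ∸ 1)))
    class-below q i<m = s≤s (subst (λ i → P (v (q * r + a)) ≤ P (v i)) (sym last≡)
      (even-chain a (<-trans (n<1+n a) a+1<r) even-a q (suc q0) q≤q0+1 (subst (_< m) last≡ last<m)))
      where
      q≤q0+1 : q ≤ suc q0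
      q≤q0+1 = quotient-≤ q (suc q0) a (suc a) a+1<r (subst (q * r + a <_) (trans m≡′ (sym (+-suc _ a))) i<m)

    -- class a + 1 is decreasing and ends with v_{k-1}, which lies above x
    class-above : ∀ q → q * r + suc a < m → P x ≤ P (v (q * r + suc a))
    class-above q i<m = <⇒≤ (<-≤-trans x<u (subst (λ i → P (v i) ≤ P (v (q * r + suc a))) (sym k′≡′)
      (odd-chain (suc a) a+1<r (not-both-even even-a) q q0 q≤q0 (subst (_< m) k′≡′ k′<m))))
      where
      q≤q0 : q ≤ q0
      q≤q0 = s≤s⁻¹ (quotient-< q (suc q0) (suc a) (suc a) ≤-refl
                      (subst (q * r + suc a <_) (trans m≡′ (sym (+-suc _ a))) i<m))

    placement : Placement
    placement = record
      { frame′    = moved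
      ; inFrame′  = moved-inFrame inFrame class-below class-above
      ; x-above   = subst (λ j → P (first′ j) ≤ P x) (sym j0≡) (≤-reflexive (cong P first′-next))
      ; x-below   = subst (λ j → P x < end′ j) (sym j0≡)
                      (subst (P x <_) (sym end′-next) (<-trans x<u (proj₂ u-located)))
      ; continues = (λ even-j0 → contradiction even-j0 odd-j0) , (λ _ → x<u)
      }

  extended : IsZigzag H (suc k′ + 1) (snoc v m x)
  extended with proj₁ x∈X
  ... | inj₁ (odd-k  , x∈I) = placement⇒zigzag (OddCase.placement odd-k x∈I)
  ... | inj₂ (even-k , x∈I) = placement⇒zigzag (EvenCase.placement even-k x∈I)

proposition2p3 : (n r k : ℕ) → 2 ≤ r → Even r → 1 ≤ k → (H : CGH n r) →
    (v : ℕ → Fin n) → IsZigzag H k v →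
    (x : Fin n) → x ∈X[ H , k , v ] →
    IsZigzag H (k + 1) (snoc v (k + r ∸ 1) x)
proposition2p3 n (suc (suc r′)) (suc k′) _ even-r _ H v Z x x∈X = Extension.extended H even-r Z x x∈X
proposition2p3 n (suc zero) _ (s≤s ()) _ _ _ _ _ _ _
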